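{- Let $(G,W,R,k)$ be an instance of \textsc{Disjoint Independent Feedback Vertex Set} and $F=V(G)\setminus W$. (1) If $v\in R$ satisfies $\mathrm{Gdeg}_W(v)\ge 1$ or $\mathrm{Tdeg}(v)\ge 1$, then $(G,W,R,k)$ is a YES instance if and only if $(G,W\cup\{v\},R\setminus\{v\},k)$ is a YES instance. (2) If $v\in F\setminus R$ is such that every vertex $w\in N(v)\setminus(W\cup R)$ has degree $2$ in $G$, and at least one such vertex $w$ exists, then $(G,W,R,k)$ is a YES instance if and only if $(G,W,R\cup(N(v)\setminus W),k)$ is a YES instance.
   Context: Graphs are undirected and may contain multiple edges and loops; $N(v)$ is the set of vertices adjacent to $v$ (each counted once), and degrees count edges with multiplicity. \textsc{Disjoint Independent Feedback Vertex Set}: the input is an undirected (multi)graph $G$, a set $W\subseteq V(G)$ such that $G\setminus W$ is a forest, a set $R\subseteq V(G)\setminus W$, and an integer $k$; it is a YES instance if there exists a set $X\subseteq V(G)\setminus(W\cup R)$ with $|X|\le k$ such that $X$ is an independent set in $G$ and $G\setminus X$ is a forest. For $v\in V(G)$ and $A\subseteq V(G)$, $\deg_A(v)$ is the number of edges (counted with multiplicity) with one endpoint $v$ and the other in $A$. A vertex $u\in F\setminus R$ is \emph{P-nice} if $u$ has degree $2$ and exactly one of its incident edges has its other endpoint in $W$. For $v\in F$, $\mathrm{Ndeg}(v)$ is the number of P-nice neighbors of $v$, and $\mathrm{Gdeg}_W(v)=\mathrm{Ndeg}(v)+\deg_W(v)$. A vertex $u\in F\setminus R$ is a \emph{P-tent}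 if $\mathrm{Gdeg}_W(u)=2$ and $u$ has degree $3$. For $v\in F$, $\mathrm{Tdeg}(v)$ is the number of neighbors of $v$ that are P-tents. -}

module Defs where

import Data.Nat
open import Data.Nat using (ℕ; zero; suc; _+_)
open import Data.Fin using (Fin; zero; suc; inject₁; fromℕ)
open import Data.Fin.Properties using (any?; _≟_)
open import Data.Fin.Subset using (Subset; _∈_; _∉_; _∪_; ∁; ∣_∣)
open import Data.Fin.Subset.Properties using (_∈?_)
open import Data.Product using (Σ; ∃; _×_; _,_; proj₁; proj₂)
open import Data.Sum using (_⊎_)
open import Data.Empty using (⊥)
open import Data.Vec using (tabulate)
open import Function.Definitions using (Injective)
open import Relation.Nullary using (¬_; Dec; yes; no; does)
import Relation.Nullary.Decidable
open import Relation.Nullary.Decidable using (_×-dec_; _⊎-dec_)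
open import Relation.Binary.PropositionalEquality using (_≡_)

-- A finite undirected multigraph (loops and parallel edges allowed):
-- vertices Fin n, edges Fin m, each edge has an (unordered) pair of endpoints.
record Graph : Set where
  field
    n   : ℕ
    m   : ℕ
    ends : Fin m → Fin n × Fin n

open Graph public

V : Graph → Set
V G = Fin (n G)

VSet : Graph → Set
VSet G = Subset (n G)

sumFin : (k : ℕ) → (Fin k → ℕ) → ℕ
sumFin zero    f = 0
sumFin (suc k) f = f zero + sumFin k (λ i → f (suc i))

ind : ∀ {P : Set} → Dec P → ℕ
ind (yes _) = 1
ind (no _)  = 0

Joins : (G : Graph) → Fin (m G) → V G → V G → Set
Joins G e a b = (proj₁ (ends G e) ≡ a × proj₂ (ends G e) ≡ b)
              ⊎ (proj₁ (ends G e) ≡ b × proj₂ (ends G e) ≡ a)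

joins? : (G : Graph) → ∀ e a b → Dec (Joins G e a b)
joins? G e a b = ((proj₁ (ends G e) ≟ a) ×-dec (proj₂ (ends G e) ≟ b))
               ⊎-dec ((proj₁ (ends G e) ≟ b) ×-dec (proj₂ (ends G e) ≟ a))

Adj : (G : Graph) → V G → V G → Set
Adj G v u = ∃ λ e → Joins G e v u

adj? : (G : Graph) → ∀ v u → Dec (Adj G v u)
adj? G v u = any? (λ e → joins? G e v u)

N : (G : Graph) → V G → VSet G
N G v = tabulate (λ u → does (adj? G v u))

-- degree, counting edges with multiplicity (a loop contributes 2)
deg : (G : Graph) → V G → ℕ
deg G v = sumFin (m G) (λ e → ind (proj₁ (ends G e) ≟ v) + ind (proj₂ (ends G e) ≟ v))

degIn : (G : Graph) → VSet G → V G → ℕ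
degIn G A v = sumFin (m G) (λ e →
    ind ((proj₁ (ends G e) ≟ v) ×-dec (proj₂ (ends G e) ∈? A))
  + ind ((proj₂ (ends G e) ≟ v) ×-dec (proj₁ (ends G e) ∈? A)))

-- A cycle avoiding the vertex set X: a closed walk v₀ e₀ v₁ … e_l v_{l+1} = v₀
-- of length l+1 ≥ 1 with pairwise distinct vertices v₀…v_l and pairwise distinct edges.
record CycleAvoiding (G : Graph) (X : VSet G) : Set where
  field
    len   : ℕ
    verts : Fin (suc (suc len)) → V G
    edges : Fin (suc len) → Fin (m G)
    closed   : verts (fromℕ (suc len)) ≡ verts zero
    vdistinct : Injective _≡_ _≡_ (λ i → verts (inject₁ i))
    edistinct : Injective _≡_ _≡_ edges
    step     : ∀ i → Joins G (edges i) (verts (inject₁ i)) (verts (suc i))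
    avoid    : ∀ i → verts i ∉ X

ForestMinus : (G : Graph) → VSet G → Set
ForestMinus G X = ¬ CycleAvoiding G X

-- X is an independent set in G (no edge, including loops, has both ends in X)
Independent : (G : Graph) → VSet G → Set
Independent G X = ∀ e → ¬ (proj₁ (ends G e) ∈ X × proj₂ (ends G e) ∈ X)

IsInstance : (G : Graph) → VSet G → VSet G → ℕ → Set
IsInstance G W R k = ForestMinus G W × (∀ v → v ∈ R → v ∉ W)

YesInstance : (G : Graph) → VSet G → VSet G → ℕ → Set
YesInstance G W R k =
  Σ (VSet G) λ X →
      (∀ v → v ∈ X → v ∉ W × v ∉ R)
    × ∣ X ∣ Data.Nat.≤ k
    × Independent G X
    × ForestMinus G X

F : (G : Graph) → VSet G → VSet G
F G W = ∁ W

PNice : (G : Graph) → VSet G → VSet G → V G → Set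
PNice G W R u = u ∉ W × u ∉ R × deg G u ≡ 2 × degIn G W u ≡ 1

pNice? : (G : Graph) → ∀ W R u → Dec (PNice G W R u)
pNice? G W R u =
  Relation.Nullary.Decidable.¬? (u ∈? W) ×-dec Relation.Nullary.Decidable.¬? (u ∈? R)
  ×-dec (deg G u Data.Nat.≟ 2) ×-dec (degIn G W u Data.Nat.≟ 1)

Ndeg : (G : Graph) → VSet G → VSet G → V G → ℕ
Ndeg G W R v = sumFin (n G) (λ u → ind (adj? G v u ×-dec pNice? G W R u))

GdegW : (G : Graph) → VSet G → VSet G → V G → ℕ
GdegW G W R v = Ndeg G W R v + degIn G W v

PTent : (G : Graph) → VSet G → VSet G → V G → Set
PTent G W R u = u ∉ W × u ∉ R × GdegW G W R u ≡ 2 × deg G u ≡ 3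

pTent? : (G : Graph) → ∀ W R u → Dec (PTent G W R u)
pTent? G W R u =
  Relation.Nullary.Decidable.¬? (u ∈? W) ×-dec Relation.Nullary.Decidable.¬? (u ∈? R)
  ×-dec (GdegW G W R u Data.Nat.≟ 2) ×-dec (deg G u Data.Nat.≟ 3)

Tdeg : (G : Graph) → VSet G → VSet G → V G → ℕ
Tdeg G W R v = sumFin (n G) (λ u → ind (adj? G v u ×-dec pTent? G W R u))

module Submission where

-- (1) A solution X must avoid W ∪ R.  For v ∈ R, the sets W ∪ R and
--     (W ∪ {v}) ∪ (R ∖ {v}) coincide, so moving v from R to W changes
--     nothing about which sets are solutions (the degree hypotheses of the
--     rule only serve to keep the new instance useful, not to make it
--     equivalent).
-- (2) Let v ∉ W ∪ R be such that its neighbours outside W ∪ R have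
--     degree 2.  Forbidding N(v) ∖ W only shrinks the set of solutions; for
--     the converse, a solution X meeting N(v) is exchanged for
--     X' = (X ∖ N(v)) ∪ {v}.  X' is no larger, avoids N(v), and is
--     independent since v has no loop.  G ∖ X' is a forest: a cycle of
--     G ∖ X' through a vertex w ∈ X ∩ N(v) would give w two cycle edges plus
--     the edge to v ∈ X', i.e. degree ≥ 3, contradicting deg w = 2.

open import Defs
open import Data.Nat using (ℕ; _≥_)
open import Data.Fin.Subset using (_∈_; _∉_; _∪_; _─_; _-_; ⁅_⁆)
open import Data.Product using (∃; _×_)
open import Data.Sum using (_⊎_)
open import Function.Bundles using (_⇔_)
open import Relation.Binary.PropositionalEquality using (_≡_)

open import Data.Nat using (suc; _+_; _≤_; z≤n; s≤s)
open import Data.Nat.Properties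
  using (≤-refl; ≤-trans; +-comm; +-mono-≤; +-monoʳ-≤; +-suc; m≤m+n; m≤n+m; +-commutativeSemigroup; module ≤-Reasoning)
open import Algebra.Properties.CommutativeSemigroup +-commutativeSemigroup using (x∙yz≈y∙xz)
open import Data.Fin using (Fin; zero; suc; inject₁; fromℕ)
open import Data.Fin.Properties using (any?; _≟_; 0≢1+n; suc-injective)
open import Data.Fin.Subset using (Subset; inside; outside; ∣_∣)
open import Data.Fin.Subset.Properties
  using (_∈?_; x∈p∪q⁻; x∈p∪q⁺; x∈⁅x⁆; x∈⁅y⁆⇒x≡y; p─q⊆p; x∈p∧x∉q⇒x∈p─q; x∈p∩q⁺;
         p∩q≢∅⇒∣p─q∣<∣p∣; ∣⁅x⁆∣≡1; ∣p∣≤∣x∷p∣)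
open import Data.Vec using ([]; _∷_; there)
open import Data.Vec.Properties using ([]=⇒lookup; lookup⇒[]=; lookup∘tabulate)
open import Data.Vec.Functional using (updateAt)
open import Data.Vec.Functional.Properties using (updateAt-minimal)
open import Data.Product using (_,_; proj₁; proj₂)
open import Data.Sum using (inj₁; inj₂; [_,_])
open import Data.Bool using (true)
open import Data.Empty using (⊥-elim)
open import Function using (_∘_)
open import Relation.Nullary using (¬_; Dec; yes; no; does)
open import Relation.Nullary.Decidable using (_×-dec_; dec-true)
open import Relation.Binary.PropositionalEquality using (_≢_; refl; sym; trans; cong; cong₂; subst)
open import Function.Bundles using (mk⇔)

clear : ∀ {k} → (Fin k → ℕ) → Fin k → Fin k → ℕ
clear f a = updateAt f a (λ _ → 0)

sumFin-extract : ∀ k (f : Fin k → ℕ) a → sumFin k f ≡ f a + sumFin k (clear f a)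
sumFin-extract (suc k) f zero    = refl
sumFin-extract (suc k) f (suc a) =
  trans (cong (f zero +_) (sumFin-extract k (f ∘ suc) a))
        (x∙yz≈y∙xz (f zero) (f (suc a)) (sumFin k (clear (f ∘ suc) a)))

term≤sumFin : ∀ k (f : Fin k → ℕ) a → f a ≤ sumFin k f
term≤sumFin k f a = subst (f a ≤_) (sym (sumFin-extract k f a)) (m≤m+n (f a) _)

terms₂≤sumFin : ∀ k (f : Fin k → ℕ) a b → a ≢ b → f a + f b ≤ sumFin k f
terms₂≤sumFin k f a b a≢b = begin
  f a + f b                   ≡⟨ cong (f a +_) (sym (updateAt-minimal b a f (a≢b ∘ sym))) ⟩
  f a + clear f a b           ≤⟨ +-monoʳ-≤ (f a) (term≤sumFin k (clear f a) b) ⟩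
  f a + sumFin k (clear f a)  ≡⟨ sym (sumFin-extract k f a) ⟩
  sumFin k f                  ∎
  where open ≤-Reasoning

terms₃≤sumFin : ∀ k (f : Fin k → ℕ) a b c → a ≢ b → a ≢ c → b ≢ c →
                f a + (f b + f c) ≤ sumFin k f
terms₃≤sumFin k f a b c a≢b a≢c b≢c = begin
  f a + (f b + f c)                     ≡⟨ cong (f a +_) (sym (cong₂ _+_ (unchanged b a≢b) (unchanged c a≢c))) ⟩
  f a + (clear f a b + clear f a c)     ≤⟨ +-monoʳ-≤ (f a) (terms₂≤sumFin k (clear f a) b c b≢c) ⟩
  f a + sumFin k (clear f a)            ≡⟨ sym (sumFin-extract k f a) ⟩
  sumFin k f                            ∎
  where
  open ≤-Reasoning
  unchanged : ∀ x → a ≢ x → clear f a x ≡ f x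
  unchanged x a≢x = updateAt-minimal x a f (a≢x ∘ sym)

x∈p─q⇒x∉q : ∀ {n} (p q : Subset n) {x} → x ∈ p ─ q → x ∉ q
x∈p─q⇒x∉q (_ ∷ p) (_ ∷ q) (there x∈p─q) (there x∈q) = x∈p─q⇒x∉q p q x∈p─q x∈q

∣p∪q∣≤∣p∣+∣q∣ : ∀ {n} (p q : Subset n) → ∣ p ∪ q ∣ ≤ ∣ p ∣ + ∣ q ∣
∣p∪q∣≤∣p∣+∣q∣ []            []            = z≤n
∣p∪q∣≤∣p∣+∣q∣ (inside ∷ p)  (t ∷ q)       =
  s≤s (≤-trans (∣p∪q∣≤∣p∣+∣q∣ p q) (+-monoʳ-≤ ∣ p ∣ (∣p∣≤∣x∷p∣ t q)))
∣p∪q∣≤∣p∣+∣q∣ (outside ∷ p) (inside ∷ q)  =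
  subst (suc ∣ p ∪ q ∣ ≤_) (sym (+-suc ∣ p ∣ ∣ q ∣)) (s≤s (∣p∪q∣≤∣p∣+∣q∣ p q))
∣p∪q∣≤∣p∣+∣q∣ (outside ∷ p) (outside ∷ q) = ∣p∪q∣≤∣p∣+∣q∣ p q

suc≢inject₁ : ∀ {l} (j : Fin l) → suc j ≢ inject₁ j
suc≢inject₁ zero    ()
suc≢inject₁ (suc j) eq = suc≢inject₁ j (suc-injective eq)

last-or-inject₁ : ∀ {l} (i : Fin (suc l)) → i ≡ fromℕ l ⊎ ∃ λ j → inject₁ j ≡ i
last-or-inject₁ {Data.Nat.zero} zero = inj₁ refl
last-or-inject₁ {suc l} zero         = inj₂ (zero , refl)
last-or-inject₁ {suc l} (suc i) with last-or-inject₁ i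
... | inj₁ i≡last      = inj₁ (cong suc i≡last)
... | inj₂ (j , j≡i)   = inj₂ (suc j , cong suc j≡i)

ind-≥1 : ∀ {P : Set} (d : Dec P) → P → 1 ≤ ind d
ind-≥1 (yes _) _ = s≤s z≤n
ind-≥1 (no ¬p) p = ⊥-elim (¬p p)

module _ (G : Graph) where

  incidence : V G → Fin (m G) → ℕ
  incidence u e = ind (proj₁ (ends G e) ≟ u) + ind (proj₂ (ends G e) ≟ u)

  joins-sym : ∀ {e a b} → Joins G e a b → Joins G e b a
  joins-sym (inj₁ ends≡) = inj₂ ends≡
  joins-sym (inj₂ ends≡) = inj₁ ends≡

  incidence-≥1 : ∀ {e u b} → Joins G e u b → 1 ≤ incidence u e
  incidence-≥1 {e} (inj₁ (p≡u , _)) = ≤-trans (ind-≥1 (proj₁ (ends G e) ≟ _) p≡u) (m≤m+n _ _)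
  incidence-≥1 {e} (inj₂ (_ , q≡u)) = ≤-trans (ind-≥1 (proj₂ (ends G e) ≟ _) q≡u) (m≤n+m _ _)

  incidence-loop : ∀ {e u} → Joins G e u u → 2 ≤ incidence u e
  incidence-loop {e} (inj₁ (p≡u , q≡u)) =
    +-mono-≤ (ind-≥1 (proj₁ (ends G e) ≟ _) p≡u) (ind-≥1 (proj₂ (ends G e) ≟ _) q≡u)
  incidence-loop {e} (inj₂ (p≡u , q≡u)) =
    +-mono-≤ (ind-≥1 (proj₁ (ends G e) ≟ _) p≡u) (ind-≥1 (proj₂ (ends G e) ≟ _) q≡u)

  joins-end : ∀ {e a b x y} → Joins G e a b → Joins G e x y → a ≡ x ⊎ a ≡ y
  joins-end (inj₁ (p≡a , _)) (inj₁ (p≡x , _)) = inj₁ (trans (sym p≡a) p≡x)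
  joins-end (inj₁ (p≡a , _)) (inj₂ (p≡y , _)) = inj₂ (trans (sym p≡a) p≡y)
  joins-end (inj₂ (_ , q≡a)) (inj₁ (_ , q≡y)) = inj₂ (trans (sym q≡a) q≡y)
  joins-end (inj₂ (_ , q≡a)) (inj₂ (_ , q≡x)) = inj₁ (trans (sym q≡a) q≡x)

  adj⇒∈N : ∀ {v u} → Adj G v u → u ∈ N G v
  adj⇒∈N {v} {u} vu = lookup⇒[]= u (N G v)
    (trans (lookup∘tabulate (λ u → does (adj? G v u)) u) (dec-true (adj? G v u) vu))

  ∈N⇒adj : ∀ {v u} → u ∈ N G v → Adj G v u
  ∈N⇒adj {v} {u} u∈N = witness (adj? G v u)
    (trans (sym (lookup∘tabulate (λ u → does (adj? G v u)) u)) ([]=⇒lookup u∈N))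
    where
    witness : (d : Dec (Adj G v u)) → does d ≡ true → Adj G v u
    witness (yes vu) _ = vu
    witness (no _)   ()

module _ {G : Graph} {Y : VSet G} (C : CycleAvoiding G Y) where
  open CycleAvoiding C

  cycle-position : ∀ i → ∃ λ j → verts (inject₁ j) ≡ verts i
  cycle-position i with last-or-inject₁ i
  ... | inj₁ refl          = zero , sym closed
  ... | inj₂ (j , j≡i)     = j , cong verts j≡i

  cycle-retarget : ∀ {Z} → (∀ i → verts i ∉ Z) → CycleAvoiding G Z
  cycle-retarget avoids-Z = record
    { len = len ; verts = verts ; edges = edges ; closed = closed
    ; vdistinct = vdistinct ; edistinct = edistinct ; step = step ; avoid = avoids-Z }

  cycle-edge-end-avoids : ∀ i {e a b} → edges i ≡ e → Joins G e a b → a ∉ Y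
  cycle-edge-end-avoids i refl ab with joins-end G ab (step i)
  ... | inj₁ refl = avoid (inject₁ i)
  ... | inj₂ refl = avoid (suc i)

cycle-degree : ∀ {G Y} (C : CycleAvoiding G Y) j e →
  (∀ i → CycleAvoiding.edges C i ≢ e) →
  2 + incidence G (CycleAvoiding.verts C (inject₁ j)) e ≤ deg G (CycleAvoiding.verts C (inject₁ j))
cycle-degree {G} record { edges = es ; edistinct = edistinct ; step = step }
  (suc j) e fresh =
  ≤-trans (+-mono-≤ (incidence-≥1 G (step (suc j)))
                    (+-mono-≤ (incidence-≥1 G (joins-sym G (step (inject₁ j)))) ≤-refl))
          (terms₃≤sumFin (m G) (incidence G _) (es (suc j)) (es (inject₁ j)) e
             (suc≢inject₁ j ∘ edistinct) (fresh (suc j)) (fresh (inject₁ j)))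
cycle-degree {G} record { len = Data.Nat.zero ; edges = es ; closed = closed ; step = step }
  zero e fresh =
  ≤-trans (+-mono-≤ (incidence-loop G (subst (Joins G (es zero) _) closed (step zero))) ≤-refl)
          (terms₂≤sumFin (m G) (incidence G _) (es zero) e (fresh zero))
cycle-degree {G} record { len = suc l ; edges = es ; closed = closed ; edistinct = edistinct ; step = step }
  zero e fresh =
  ≤-trans (+-mono-≤ (incidence-≥1 G (step zero))
                    (+-mono-≤ (incidence-≥1 G (joins-sym G (subst (Joins G (es last) _) closed (step last))))
                              ≤-refl))
          (terms₃≤sumFin (m G) (incidence G _) (es zero) (es last) e
             (0≢1+n ∘ edistinct) (fresh zero) (fresh last))
  where
  last : Fin (suc (suc l))
  last = fromℕ (suc l)

-- A vertex on a cycle avoiding Y that is adjacent to a vertex of Y has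
-- degree at least 3: two cycle edges plus the edge into Y.
attached-cycle-vertex : ∀ {G Y a} (C : CycleAvoiding G Y) i → a ∈ Y →
  Adj G a (CycleAvoiding.verts C i) → 3 ≤ deg G (CycleAvoiding.verts C i)
attached-cycle-vertex {G} {a = a} C i a∈Y (e , a~u) with cycle-position C i
... | j , uⱼ≡uᵢ = subst (λ u → 3 ≤ deg G u) uⱼ≡uᵢ
  (≤-trans (s≤s (s≤s (incidence-≥1 G (joins-sym G (subst (Joins G e a) (sym uⱼ≡uᵢ) a~u)))))
           (cycle-degree C j e fresh))
  where
  fresh : ∀ i → CycleAvoiding.edges C i ≢ e
  fresh i eᵢ≡e = cycle-edge-end-avoids C i eᵢ≡e a~u a∈Y

-- A single loop at a vertex outside W is a cycle of G ∖ W; so when G ∖ W is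
-- a forest, vertices outside W carry no loops.
no-loop : ∀ {G W v} → ForestMinus G W → v ∉ W → ¬ Adj G v v
no-loop {v = v} forest v∉W (e , loop) = forest (record
  { len = 0 ; verts = λ _ → v ; edges = λ _ → e ; closed = refl
  ; vdistinct = λ { {zero} {zero} _ → refl }
  ; edistinct = λ { {zero} {zero} _ → refl }
  ; step = λ _ → loop ; avoid = λ _ → v∉W })

solution-transfer : ∀ {G W R W' R' k} (sol : YesInstance G W R k) →
  (∀ x → x ∈ proj₁ sol → x ∉ W' × x ∉ R') → YesInstance G W' R' k
solution-transfer (X , _ , small , independent , forest) avoids' =
  X , avoids' , small , independent , forest

avoid-release : ∀ {n} {W R : Subset n} {v x} → v ∈ R →
  x ∉ W × x ∉ R → x ∉ W ∪ ⁅ v ⁆ × x ∉ R - v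
avoid-release {W = W} {v = v} v∈R (x∉W , x∉R) =
  [ x∉W , (λ x∈⁅v⁆ → x∉R (subst (_∈ _) (sym (x∈⁅y⁆⇒x≡y v x∈⁅v⁆)) v∈R)) ] ∘ x∈p∪q⁻ W ⁅ v ⁆ ,
  x∉R ∘ p─q⊆p _ ⁅ v ⁆

avoid-unrelease : ∀ {n} {W R : Subset n} {v x} →
  x ∉ W ∪ ⁅ v ⁆ × x ∉ R - v → x ∉ W × x ∉ R
avoid-unrelease (x∉W∪v , x∉R-v) =
  x∉W∪v ∘ x∈p∪q⁺ ∘ inj₁ ,
  λ x∈R → x∉R-v (x∈p∧x∉q⇒x∈p─q x∈R (λ x∈⁅v⁆ → x∉W∪v (x∈p∪q⁺ (inj₂ x∈⁅v⁆))))

release : ∀ G (W R : VSet G) k v → v ∈ R →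
  YesInstance G W R k ⇔ YesInstance G (W ∪ ⁅ v ⁆) (R - v) k
release G W R k v v∈R = mk⇔
  (λ sol → solution-transfer sol (λ x x∈X → avoid-release v∈R (proj₁ (proj₂ sol) x x∈X)))
  (λ sol → solution-transfer sol (λ x x∈X → avoid-unrelease {v = v} (proj₁ (proj₂ sol) x x∈X)))

module Exchange (G : Graph) (W R : VSet G) (v : V G)
  (v∉W : v ∉ W) (v∉R : v ∉ R) (no-loop-v : ¬ Adj G v v) (X : VSet G) where

  swapped : VSet G
  swapped = (X ─ N G v) ∪ ⁅ v ⁆

  swapped-member : ∀ {x} → x ∈ swapped → (x ∈ X × x ∉ N G v) ⊎ x ≡ v
  swapped-member {x} x∈X' with x∈p∪q⁻ (X ─ N G v) ⁅ v ⁆ x∈X'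
  ... | inj₁ x∈X─N = inj₁ (p─q⊆p X (N G v) x∈X─N , x∈p─q⇒x∉q X (N G v) x∈X─N)
  ... | inj₂ x∈⁅v⁆ = inj₂ (x∈⁅y⁆⇒x≡y v x∈⁅v⁆)

  swapped-size : ∀ {k w} → ∣ X ∣ ≤ k → w ∈ X → w ∈ N G v → ∣ swapped ∣ ≤ k
  swapped-size {k} {w} small w∈X w∈N = begin
    ∣ swapped ∣                  ≤⟨ ∣p∪q∣≤∣p∣+∣q∣ (X ─ N G v) ⁅ v ⁆ ⟩
    ∣ X ─ N G v ∣ + ∣ ⁅ v ⁆ ∣    ≡⟨ cong (∣ X ─ N G v ∣ +_) (∣⁅x⁆∣≡1 v) ⟩
    ∣ X ─ N G v ∣ + 1            ≡⟨ +-comm _ 1 ⟩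
    suc ∣ X ─ N G v ∣            ≤⟨ p∩q≢∅⇒∣p─q∣<∣p∣ X (N G v) (w , x∈p∩q⁺ (w∈X , w∈N)) ⟩
    ∣ X ∣                        ≤⟨ small ⟩
    k                            ∎
    where open ≤-Reasoning

  swapped-avoids : (∀ x → x ∈ X → x ∉ W × x ∉ R) →
    ∀ x → x ∈ swapped → x ∉ W × x ∉ R ∪ (N G v ─ W)
  swapped-avoids avoids x x∈X' with swapped-member x∈X'
  ... | inj₁ (x∈X , x∉N) =
    proj₁ (avoids x x∈X) , [ proj₂ (avoids x x∈X) , x∉N ∘ p─q⊆p (N G v) W ] ∘ x∈p∪q⁻ R (N G v ─ W)
  ... | inj₂ refl =
    v∉W , [ v∉R , no-loop-v ∘ ∈N⇒adj G ∘ p─q⊆p (N G v) W ] ∘ x∈p∪q⁻ R (N G v ─ W)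

  -- v has no loop and no neighbour left in X ─ N(v).
  swapped-independent : Independent G X → Independent G swapped
  swapped-independent independent e (p∈X' , q∈X') with swapped-member p∈X' | swapped-member q∈X'
  ... | inj₁ (p∈X , _)   | inj₁ (q∈X , _)   = independent e (p∈X , q∈X)
  ... | inj₁ (_ , p∉N)   | inj₂ q≡v         = p∉N (adj⇒∈N G (e , inj₂ (refl , q≡v)))
  ... | inj₂ p≡v         | inj₁ (_ , q∉N)   = q∉N (adj⇒∈N G (e , inj₁ (p≡v , refl)))
  ... | inj₂ p≡v         | inj₂ q≡v         = no-loop-v (e , inj₁ (p≡v , q≡v))

  -- A cycle avoiding the swapped set cannot pass through X: the only
  -- candidates are neighbours of v, which would then have degree ≥ 3.
  swapped-forest : (∀ w → w ∈ X → w ∈ N G v → ¬ 3 ≤ deg G w) →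
    ForestMinus G X → ForestMinus G swapped
  swapped-forest low-degree forest C = forest (cycle-retarget C avoids-X)
    where
    open CycleAvoiding C
    v∈X' : v ∈ swapped
    v∈X' = x∈p∪q⁺ (inj₂ (x∈⁅x⁆ v))
    avoids-X : ∀ i → verts i ∉ X
    avoids-X i uᵢ∈X with verts i ∈? N G v
    ... | yes uᵢ∈N = low-degree (verts i) uᵢ∈X uᵢ∈N
                       (attached-cycle-vertex C i v∈X' (∈N⇒adj G uᵢ∈N))
    ... | no  uᵢ∉N = avoid i (x∈p∪q⁺ (inj₁ (x∈p∧x∉q⇒x∈p─q uᵢ∈X uᵢ∉N)))

  exchange : ∀ {k w} → (∀ x → x ∈ X → x ∉ W × x ∉ R) → ∣ X ∣ ≤ k →
    Independent G X → ForestMinus G X → w ∈ X → w ∈ N G v →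
    (∀ w → w ∈ X → w ∈ N G v → ¬ 3 ≤ deg G w) →
    YesInstance G W (R ∪ (N G v ─ W)) k
  exchange avoids small independent forest w∈X w∈N low-degree =
    swapped , swapped-avoids avoids , swapped-size small w∈X w∈N ,
    swapped-independent independent , swapped-forest low-degree forest

forbid-neighbours : ∀ G (W R : VSet G) k v → ForestMinus G W → v ∉ W → v ∉ R →
  (∀ w → w ∈ N G v → w ∉ W → w ∉ R → deg G w ≡ 2) →
  YesInstance G W R k ⇔ YesInstance G W (R ∪ (N G v ─ W)) k
forbid-neighbours G W R k v forestW v∉W v∉R degree-two = mk⇔ forward backward
  where
  backward : YesInstance G W (R ∪ (N G v ─ W)) k → YesInstance G W R k
  backward sol = solution-transfer sol λ x x∈X →
    let x∉W , x∉R∪N = proj₁ (proj₂ sol) x x∈X in x∉W , x∉R∪N ∘ x∈p∪q⁺ ∘ inj₁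
  forward : YesInstance G W R k → YesInstance G W (R ∪ (N G v ─ W)) k
  forward sol@(X , avoids , small , independent , forest)
    with any? (λ w → (w ∈? X) ×-dec (w ∈? N G v))
  ... | no disjoint = solution-transfer sol λ x x∈X →
    proj₁ (avoids x x∈X) ,
    [ proj₂ (avoids x x∈X) , (λ x∈N─W → disjoint (x , x∈X , p─q⊆p (N G v) W x∈N─W)) ] ∘ x∈p∪q⁻ R (N G v ─ W)
  ... | yes (w , w∈X , w∈N) =
    Exchange.exchange G W R v v∉W v∉R (no-loop forestW v∉W) X
      avoids small independent forest w∈X w∈N low-degree
    where
    low-degree : ∀ u → u ∈ X → u ∈ N G v → ¬ 3 ≤ deg G u
    low-degree u u∈X u∈N 3≤deg = 3≰2
      (subst (3 ≤_) (degree-two u u∈N (proj₁ (avoids u u∈X)) (proj₂ (avoids u u∈X))) 3≤deg)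
      where
      3≰2 : ¬ 3 ≤ 2
      3≰2 (s≤s (s≤s ()))

-- The theorem.
mainTheorem4 : (G : Graph) (W R : VSet G) (k : ℕ) → IsInstance G W R k →
    (∀ v → v ∈ R → (GdegW G W R v ≥ 1 ⊎ Tdeg G W R v ≥ 1) →
      (YesInstance G W R k ⇔ YesInstance G (W ∪ ⁅ v ⁆) (R - v) k))
  × (∀ v → v ∉ W → v ∉ R →
      (∀ w → w ∈ N G v → w ∉ W → w ∉ R → deg G w ≡ 2) →
      (∃ λ w → w ∈ N G v × w ∉ W × w ∉ R) →
      (YesInstance G W R k ⇔ YesInstance G W (R ∪ (N G v ─ W)) k))
mainTheorem4 G W R k (forestW , _) =
  (λ v v∈R _ → release G W R k v v∈R) ,
  (λ v v∉W v∉R degree-two _ → forbid-neighbours G W R k v forestW v∉W v∉R degree-two)
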